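{- If a VERS is expanding, then its history graph is (Gromov) hyperbolic.
   Context: Graphs have vertex set, edge set and maps $\iota,\tau$ (initial/terminal vertex); loops and parallel edges allowed; paths, geodesics and graph distance ignore orientation (distance $\infty$ across components). Let $\Sigma$ be a finite directed graph, $s\in V(\Sigma)$. The language $\mathcal L$ is the set of finite directed paths in $\Sigma$ from $s$, written as words $x_n\cdots x_1$ over $E(\Sigma)$ ($\iota(x_1)=s$, $\tau(x_i)=\iota(x_{i+1})$), including the empty word $\varepsilon$; the type of a word is the terminal vertex of its path ($s$ for $\varepsilon$). For a color set $C$ and $\kappa\colon C\to V(\Sigma)^2$, a graph with $C$-colored edges and $V(\Sigma)$-typed vertices is $\kappa$-compatible if every edge $e$ of color $c$ has $\mathrm{type}(\iota(e))=\kappa(c)_1$ and $\mathrm{type}(\tau(e))=\kappa(c)_2$. A VERS consists of $(\Sigma,s)$, a finite color set $C$, $\kappa$, for each $c\in C$ a $\kappa$-compatible $C$-colored graph $R_c$ with vertex set $\{x\mathrm i:\iota(x)=\kappa(c)_1\}\cup\{y\mathrm t:\iota(y)=\kappa(c)_2\}$ ($x,y\in E(\Sigma)$; $x\mathrm i,x\mathrm t$ of type $\tau(x)$), and a $\kappa$-compatible graph $\Gamma_0$: the vertex $\varepsilon$ with a bouquet of $C$-colored loops. The expansion of a $\kappa$-compatible graph $\Gamma$ has vertices $xu$ ($u\in V(\Gamma)$, $x\in E(\Sigma)$, $\iota(x)=\mathrm{type}(u)$; type $\tau(x)$) and, for each edge of $\Gamma$ from $u$ to $v$ of color $c$ and each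 edge of $R_c$ of color $c'$, a $c'$-colored edge obtained by replacing $\mathrm i$ by $u$ and $\mathrm t$ by $v$ in its endpoints. $\Gamma_{n+1}$ is the expansion of $\Gamma_n$. The $k$-th expansion is obtained by expanding $k$ times; its vertices are the words $wu$ with $u$ a vertex of the original graph and $|w|=k$ (the successors of $u$). The history graph has vertex set $\mathcal L$, vertical edges $v\to xv$ (for $v,xv\in\mathcal L$, $x\in E(\Sigma)$) and horizontal edges all edges of all $\Gamma_n$. The VERS is $n$-expanding if for every $\kappa$-compatible graph $\Gamma$ that is a path of length $n$ (with arbitrary colors and edge orientations) with endpoints $a,b$, the $n$-th expansion of $\Gamma$ contains no geodesic of length $n$ joining a successor of $a$ to a successor of $b$. It is expanding if it is $n$-expanding for some $n\in\mathbb N$. -}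

module Defs where

open import Data.Nat using (ℕ; zero; suc; _<_)
open import Data.Fin using (Fin; zero; suc; inject₁; fromℕ)
open import Data.List using (List; []; _∷_; length)
open import Data.Product using (Σ; _×_; _,_; proj₁; proj₂)
open import Data.Sum using (_⊎_)
open import Data.Bool using (Bool; true; false)
open import Data.Unit using (⊤; tt)
open import Data.Integer as ℤ using (ℤ; +_)
open import Relation.Nullary using (¬_)
open import Relation.Binary.PropositionalEquality using (_≡_)

-- Generic graph-metric notions (graph given by an adjacency relation
-- that already ignores orientation; vertex set given by a predicate).

data Walk {A : Set} (Adj : A → A → Set) : A → A → ℕ → Set where
  here : ∀ {a} → Walk Adj a a 0
  step : ∀ {a b c k} → Adj a b → Walk Adj b c k → Walk Adj a c (suc k)

Dist : {A : Set} (Adj : A → A → Set) → A → A → ℕ → Set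
Dist Adj a b k = Walk Adj a b k × (∀ m → m < k → ¬ Walk Adj a b m)

-- Gromov hyperbolicity (Gromov-product definition), with products doubled:
-- 2(x|y)_w = d(w,x) + d(w,y) - d(x,y), and
-- (x|y)_w ≥ min((x|z)_w , (y|z)_w) - δ  for all x y z w.
Hyperbolic : {A : Set} (Vtx : A → Set) (Adj : A → A → Set) → Set
Hyperbolic {A} Vtx Adj =
  Σ ℕ λ δ → ∀ (w x y z : A) → Vtx w → Vtx x → Vtx y → Vtx z →
    ∀ dxy dxz dyz dwx dwy dwz →
    Dist Adj x y dxy → Dist Adj x z dxz → Dist Adj y z dyz →
    Dist Adj w x dwx → Dist Adj w y dwy → Dist Adj w z dwz →
    ((+ dwx ℤ.+ + dwz ℤ.- + dxz) ℤ.⊓ (+ dwy ℤ.+ + dwz ℤ.- + dyz))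
      ℤ.≤ (+ dwx ℤ.+ + dwy ℤ.- + dxy) ℤ.+ + (2 ℕ.* δ)
  where import Data.Nat as ℕ

-- vertex labels of R_c : x i  or  y t
data Lbl : Set where
  ini ter : Lbl

RVert : {nV nE nC : ℕ} → (Fin nE → Fin nV) → (Fin nC → Fin nV) → (Fin nC → Fin nV) →
        Fin nC → Lbl × Fin nE → Set
RVert ι κ₁ κ₂ c (ini , x) = ι x ≡ κ₁ c
RVert ι κ₁ κ₂ c (ter , y) = ι y ≡ κ₂ c

record VERS : Set where
  field
    nV nE : ℕ
    ι τ : Fin nE → Fin nV
    s : Fin nV
    nC : ℕ
    κ₁ κ₂ : Fin nC → Fin nV
    -- replacement graphs R_c : edges r with endpoints (label , edge of Σ) and a color
    nR : Fin nC → ℕ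
    Rsrc Rtgt : (c : Fin nC) → Fin (nR c) → Lbl × Fin nE
    Rcol : (c : Fin nC) → Fin (nR c) → Fin nC
    -- Γ₀ : bouquet of nB loops at ε, with colors
    nB : ℕ
    bcol : Fin nB → Fin nC

    Rvert : ∀ c r → RVert ι κ₁ κ₂ c (Rsrc c r) × RVert ι κ₁ κ₂ c (Rtgt c r)
    -- κ-compatibility of R_c (type of x i / x t is τ x)
    Rcompat : ∀ c r → τ (proj₂ (Rsrc c r)) ≡ κ₁ (Rcol c r)
                    × τ (proj₂ (Rtgt c r)) ≡ κ₂ (Rcol c r)
    -- κ-compatibility of Γ₀ (ε has type s)
    Bcompat : ∀ b → κ₁ (bcol b) ≡ s × κ₂ (bcol b) ≡ s

module _ (𝒱 : VERS) where
  open VERS 𝒱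

  Word : Set
  Word = List (Fin nE)   -- x ∷ w  represents the word  x w  (x is the last letter)

  typeFrom : Fin nV → Word → Fin nV
  typeFrom t [] = t
  typeFrom t (x ∷ w) = τ x

  ValidFrom : Fin nV → Word → Set
  ValidFrom t [] = ⊤
  ValidFrom t (x ∷ w) = ValidFrom t w × ι x ≡ typeFrom t w

  InL : Word → Set
  InL = ValidFrom s

  -- k-th expansion of a κ-compatible graph with vertex set U and colored
  -- edge relation BE; vertices of the expansion are pairs (w , u).
  end : {U : Set} → Word × U → Word × U → Lbl × Fin nE → Word × U
  end (w , u) q (ini , x) = (x ∷ w , u)
  end p (w' , v) (ter , y) = (y ∷ w' , v)

  data ExpEdge {U : Set} (BE : U → U → Fin nC → Set) :
               ℕ → Word × U → Word × U → Fin nC → Set where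
    base : ∀ {u v c} → BE u v c → ExpEdge BE 0 ([] , u) ([] , v) c
    expd : ∀ {k p q c} → ExpEdge BE k p q c → (r : Fin (nR c)) →
           ExpEdge BE (suc k) (end p q (Rsrc c r)) (end p q (Rtgt c r)) (Rcol c r)

  ExpVertex : {U : Set} → (U → Fin nV) → ℕ → Word × U → Set
  ExpVertex ty k (w , u) = length w ≡ k × ValidFrom (ty u) w

  ExpAdj : {U : Set} (BE : U → U → Fin nC → Set) → ℕ → Word × U → Word × U → Set
  ExpAdj BE k p q = Σ (Fin nC) λ c → ExpEdge BE k p q c ⊎ ExpEdge BE k q p c

  -- Γ₀ : single vertex ε (U = ⊤) with the bouquet of loops
  Γ₀Edge : ⊤ → ⊤ → Fin nC → Set
  Γ₀Edge _ _ c = Σ (Fin nB) λ b → bcol b ≡ c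

  VertEdge : Word → Word → Set
  VertEdge v xv = Σ (Fin nE) λ x → xv ≡ x ∷ v × InL xv

  HistAdj : Word → Word → Set
  HistAdj a b = VertEdge a b ⊎ VertEdge b a
              ⊎ (Σ ℕ λ n → ExpAdj Γ₀Edge n (a , tt) (b , tt))

  -- κ-compatible path graphs of length n: vertices 0..n, edge j joins j and j+1,
  -- with color col j and orientation fwd j (true: j → j+1).
  record PathGraph (n : ℕ) : Set where
    field
      ty  : Fin (suc n) → Fin nV
      col : Fin n → Fin nC
      fwd : Fin n → Bool
      compat : ∀ j → (fwd j ≡ true  × κ₁ (col j) ≡ ty (inject₁ j) × κ₂ (col j) ≡ ty (suc j))
                   ⊎ (fwd j ≡ false × κ₁ (col j) ≡ ty (suc j) × κ₂ (col j) ≡ ty (inject₁ j))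

    Edge : Fin (suc n) → Fin (suc n) → Fin nC → Set
    Edge u v c = Σ (Fin n) λ j → col j ≡ c ×
      ((fwd j ≡ true × u ≡ inject₁ j × v ≡ suc j)
       ⊎ (fwd j ≡ false × u ≡ suc j × v ≡ inject₁ j))

  NExpanding : ℕ → Set
  NExpanding n = (P : PathGraph n) → let open PathGraph P in
    ¬ (Σ Word λ w → Σ Word λ w' →
         ExpVertex ty n (w , zero) × ExpVertex ty n (w' , fromℕ n) ×
         Dist (ExpAdj Edge n) (w , zero) (w' , fromℕ n) n)

  Expanding : Set
  Expanding = Σ ℕ NExpanding

  HistoryHyperbolic : Set
  HistoryHyperbolic = Hyperbolic InL HistAdj

module Submission where

-- A horizontal edge of Γ_{n+k} projects, by passing to ancestors n generations up, to a
-- vertex or an edge of Γ_k.  Hence every walk in the history graph can be replaced by an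
-- "arch" of no greater length: climb from both ends to a common level, cross horizontally,
-- descend.  If a horizontal walk of length N in Γ_{N+k} did not project to a strictly shorter
-- walk in Γ_k, it would be the N-th expansion of the path of edges of Γ_k it lies over, giving
-- a geodesic forbidden by N-expansion.  So a long crossing can be traded for climbing N more
-- levels at both ends, and geodesics are arches whose crossing has length at most a constant
-- B.  Comparing two such arches through the lower of their levels shows that, with word
-- length as height, d(p,r) + |q| ≤ d(p,q) + |r| + B or d(p,r) + |q| ≤ d(q,r) + |p| + B: the
-- graph is hyperbolic at the root, and Gromov's four-point argument moves the base point.

open import Defs
open import Data.Nat as ℕ using (ℕ; zero; suc; _+_; _*_; _∸_; _≤_; _<_; z≤n; s≤s; _≤?_; _<?_)
open import Data.Nat.Properties
import Data.Nat.Tactic.RingSolver as ℕ-Solver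
open import Data.Integer as ℤ using (ℤ; +_; +≤+)
import Data.Integer.Properties as ℤₚ
import Data.Integer.Tactic.RingSolver as ℤ-Solver
open import Data.Fin using (Fin; zero; suc; inject₁; fromℕ; toℕ)
open import Data.Fin.Properties using (toℕ-inject₁; toℕ-fromℕ)
open import Data.Bool using (Bool; true; false)
open import Data.List using (List; []; _∷_; length; _++_; drop; take)
open import Data.List.Properties using (drop-drop; drop-all)
open import Data.Product using (Σ; _×_; _,_; proj₁; proj₂)
import Data.Product as Prod
open import Data.Sum using (_⊎_; inj₁; inj₂)
import Data.Sum as Sum
open import Data.Unit using (⊤; tt)
open import Data.Empty using (⊥-elim)
open import Relation.Nullary using (¬_; yes; no)
open import Relation.Binary.PropositionalEquality

module _ {A : Set} {R : A → A → Set} where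

  _++ʷ_ : ∀ {a b c m n} → Walk R a b m → Walk R b c n → Walk R a c (m + n)
  here     ++ʷ w = w
  step r v ++ʷ w = step r (v ++ʷ w)

  splitʷ : ∀ m {n a b} → Walk R a b (m + n) → Σ A λ c → Walk R a c m × Walk R c b n
  splitʷ zero    w          = _ , here , w
  splitʷ (suc m) (step r w) with splitʷ m w
  ... | c , w₁ , w₂ = c , step r w₁ , w₂

  Dist⇒≤ : ∀ {a b d L} → Dist R a b d → Walk R a b L → d ≤ L
  Dist⇒≤ {L = L} (_ , minimal) w = ≮⇒≥ λ L<d → minimal L L<d w

  module _ (R-sym : ∀ {a b} → R a b → R b a) where

    private
      reverse-onto : ∀ {a b c m k} → Walk R a b m → Walk R a c k → Walk R b c (m + k)
      reverse-onto here       acc = acc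
      reverse-onto {m = suc m} {k} (step r w) acc =
        subst (Walk R _ _) (+-suc m k) (reverse-onto w (step (R-sym r) acc))

    reverseʷ : ∀ {a b m} → Walk R a b m → Walk R b a m
    reverseʷ {m = m} w = subst (Walk R _ _) (+-identityʳ m) (reverse-onto w here)

    Dist-sym : ∀ {a b d} → Dist R a b d → Dist R b a d
    Dist-sym (w , minimal) = reverseʷ w , λ m m<d w′ → minimal m m<d (reverseʷ w′)

mapʷ : {A B : Set} {R : A → A → Set} {S : B → B → Set} (f : A → B) →
       (∀ {a b} → R a b → S (f a) (f b)) → ∀ {a b m} → Walk R a b m → Walk S (f a) (f b) m
mapʷ f g here       = here
mapʷ f g (step r w) = step (g r) (mapʷ f g w)

step-or-stay : {A : Set} {R : A → A → Set} → ∀ {a b c m} → a ≡ b ⊎ R a b → Walk R b c m →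
               Σ ℕ λ m′ → m′ ≤ suc m × Walk R a c m′
step-or-stay (inj₁ refl) w = _ , n≤1+n _ , w
step-or-stay (inj₂ r)    w = _ , ≤-refl , step r w

contractʷ : {A B : Set} {R : A → A → Set} {S : B → B → Set} (f : A → B) →
            (∀ {a b} → R a b → f a ≡ f b ⊎ S (f a) (f b)) →
            ∀ {a b m} → Walk R a b m → Σ ℕ λ m′ → m′ ≤ m × Walk S (f a) (f b) m′
contractʷ f g here = 0 , z≤n , here
contractʷ f g (step r w) with contractʷ f g w
... | m′ , m′≤m , w′ with step-or-stay (g r) w′
...   | m″ , m″≤ , w″ = m″ , ≤-trans m″≤ (s≤s m′≤m) , w″

-- Twice the Gromov product of two points at distances dx, dy from the base point and dxy apart;
-- Hyperbolic is phrased with exactly these terms.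
gromov : ℕ → ℕ → ℕ → ℤ
gromov dx dy dxy = + dx ℤ.+ + dy ℤ.- + dxy

gromov-comm : ∀ dx dy dxy → gromov dx dy dxy ≡ gromov dy dx dxy
gromov-comm dx dy dxy = cong (ℤ._- + dxy) (ℤₚ.+-comm (+ dx) (+ dy))

gromov-≤ : ∀ h₀ h h′ d d′ B → d′ + h ≤ d + h′ + B →
           gromov h₀ h d ℤ.≤ gromov h₀ h′ d′ ℤ.+ + B
gromov-≤ h₀ h h′ d d′ B le = begin
  gromov h₀ h d                        ≡⟨ shift (+ h₀) (+ h) (+ d) (+ d′) ⟩
  + (d′ + h) ℤ.+ S                     ≤⟨ ℤₚ.+-monoˡ-≤ S (+≤+ le) ⟩
  + (d + h′ + B) ℤ.+ S                 ≡⟨ unshift (+ h₀) (+ h′) (+ d) (+ d′) (+ B) ⟩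
  gromov h₀ h′ d′ ℤ.+ + B              ∎
  where
  open ℤₚ.≤-Reasoning
  S : ℤ
  S = + h₀ ℤ.- + d ℤ.- + d′
  shift : ∀ h₀ h d d′ → h₀ ℤ.+ h ℤ.- d ≡ (d′ ℤ.+ h) ℤ.+ (h₀ ℤ.- d ℤ.- d′)
  shift = ℤ-Solver.solve-∀
  unshift : ∀ h₀ h′ d d′ B → (d ℤ.+ h′ ℤ.+ B) ℤ.+ (h₀ ℤ.- d ℤ.- d′) ≡ h₀ ℤ.+ h′ ℤ.- d′ ℤ.+ B
  unshift = ℤ-Solver.solve-∀

paired-sum-≤ : ∀ {a b c d p q : ℤ} →
               a ℤ.≤ p ⊎ c ℤ.≤ p → b ℤ.≤ p ⊎ d ℤ.≤ p → d ℤ.≤ q ⊎ a ℤ.≤ q → b ℤ.≤ q ⊎ c ℤ.≤ q →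
               a ℤ.+ b ℤ.≤ p ℤ.+ q ⊎ c ℤ.+ d ℤ.≤ p ℤ.+ q
paired-sum-≤ (inj₁ a≤p) _ _ (inj₁ b≤q) = inj₁ (ℤₚ.+-mono-≤ a≤p b≤q)
paired-sum-≤ {p = p} {q = q} _ (inj₁ b≤p) (inj₂ a≤q) _ =
  inj₁ (subst (_ ℤ.≤_) (ℤₚ.+-comm q p) (ℤₚ.+-mono-≤ a≤q b≤p))
paired-sum-≤ (inj₂ c≤p) _ (inj₁ d≤q) _ = inj₂ (ℤₚ.+-mono-≤ c≤p d≤q)
paired-sum-≤ {p = p} {q = q} _ (inj₂ d≤p) _ (inj₂ c≤q) =
  inj₂ (subst (_ ℤ.≤_) (ℤₚ.+-comm q p) (ℤₚ.+-mono-≤ c≤q d≤p))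
paired-sum-≤ {a} {c = c} {p = p} {q = q} (inj₁ a≤p) (inj₁ b≤p) (inj₁ d≤q) (inj₂ c≤q) with ℤₚ.≤-total a c
... | inj₁ a≤c = inj₁ (subst (_ ℤ.≤_) (ℤₚ.+-comm q p) (ℤₚ.+-mono-≤ (ℤₚ.≤-trans a≤c c≤q) b≤p))
... | inj₂ c≤a = inj₂ (ℤₚ.+-mono-≤ (ℤₚ.≤-trans c≤a a≤p) d≤q)
paired-sum-≤ {a} {c = c} {p = p} {q = q} (inj₂ c≤p) (inj₂ d≤p) (inj₂ a≤q) (inj₁ b≤q) with ℤₚ.≤-total a c
... | inj₁ a≤c = inj₁ (ℤₚ.+-mono-≤ (ℤₚ.≤-trans a≤c c≤p) b≤q)
... | inj₂ c≤a = inj₂ (subst (_ ℤ.≤_) (ℤₚ.+-comm q p) (ℤₚ.+-mono-≤ (ℤₚ.≤-trans c≤a a≤q) d≤p))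

-- Gromov products based at w differ from height-based ones by a term S symmetric in x, y, z.
rebase-≤ : ∀ hw hx hy hz dwx dwy dwz dxy dxz B →
           gromov hx hz dxz ℤ.+ gromov hw hy dwy ℤ.≤ (gromov hx hy dxy ℤ.+ + B) ℤ.+ (gromov hw hz dwz ℤ.+ + B) →
           gromov dwx dwz dxz ℤ.≤ gromov dwx dwy dxy ℤ.+ + (2 ℕ.* B)
rebase-≤ hw hx hy hz dwx dwy dwz dxy dxz B le = begin
  gromov dwx dwz dxz                                                 ≡⟨ lhs (+ hw) (+ hx) (+ hy) (+ hz) (+ dwx) (+ dwy) (+ dwz) (+ dxz) ⟩
  gromov hx hz dxz ℤ.+ gromov hw hy dwy ℤ.- S                        ≤⟨ ℤₚ.+-monoˡ-≤ (ℤ.- S) le ⟩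
  (gromov hx hy dxy ℤ.+ + B) ℤ.+ (gromov hw hz dwz ℤ.+ + B) ℤ.- S    ≡⟨ rhs (+ hw) (+ hx) (+ hy) (+ hz) (+ dwx) (+ dwy) (+ dwz) (+ dxy) (+ B) ⟩
  gromov dwx dwy dxy ℤ.+ (+ B ℤ.+ + B)                               ≡⟨ cong (λ n → gromov dwx dwy dxy ℤ.+ + (B + n)) (sym (+-identityʳ B)) ⟩
  gromov dwx dwy dxy ℤ.+ + (2 ℕ.* B)                                 ∎
  where
  open ℤₚ.≤-Reasoning
  S : ℤ
  S = + hw ℤ.+ + hx ℤ.+ + hy ℤ.+ + hz ℤ.- + dwx ℤ.- + dwy ℤ.- + dwz
  lhs : ∀ hw hx hy hz dwx dwy dwz dxz →
        dwx ℤ.+ dwz ℤ.- dxz ≡ (hx ℤ.+ hz ℤ.- dxz) ℤ.+ (hw ℤ.+ hy ℤ.- dwy) ℤ.- (hw ℤ.+ hx ℤ.+ hy ℤ.+ hz ℤ.- dwx ℤ.- dwy ℤ.- dwz)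
  lhs = ℤ-Solver.solve-∀
  rhs : ∀ hw hx hy hz dwx dwy dwz dxy B →
        (hx ℤ.+ hy ℤ.- dxy ℤ.+ B) ℤ.+ (hw ℤ.+ hz ℤ.- dwz ℤ.+ B) ℤ.- (hw ℤ.+ hx ℤ.+ hy ℤ.+ hz ℤ.- dwx ℤ.- dwy ℤ.- dwz)
          ≡ dwx ℤ.+ dwy ℤ.- dxy ℤ.+ (B ℤ.+ B)
  rhs = ℤ-Solver.solve-∀

four-point-≤ : ∀ hw hx hy hz dwx dwy dwz dxy dxz dyz B →
  let P = gromov hx hy dxy ℤ.+ + B ; Q = gromov hw hz dwz ℤ.+ + B in
  gromov hx hz dxz ℤ.+ gromov hw hy dwy ℤ.≤ P ℤ.+ Q ⊎ gromov hy hz dyz ℤ.+ gromov hw hx dwx ℤ.≤ P ℤ.+ Q →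
  gromov dwx dwz dxz ℤ.⊓ gromov dwy dwz dyz ℤ.≤ gromov dwx dwy dxy ℤ.+ + (2 ℕ.* B)
four-point-≤ hw hx hy hz dwx dwy dwz dxy dxz dyz B (inj₁ le) =
  ℤₚ.i≤j⇒i⊓k≤j _ (rebase-≤ hw hx hy hz dwx dwy dwz dxy dxz B le)
four-point-≤ hw hx hy hz dwx dwy dwz dxy dxz dyz B (inj₂ le) =
  ℤₚ.i≤j⇒k⊓i≤j _ (subst (_ ℤ.≤_) (cong (ℤ._+ _) (gromov-comm dwy dwx dxy))
    (rebase-≤ hw hy hx hz dwy dwx dwz dxy dyz B
      (subst (λ g → _ ℤ.≤ (g ℤ.+ + B) ℤ.+ _) (gromov-comm hx hy dxy) le)))

-- The height plays the role of the distance to a base point: this is hyperbolicity at that point.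
BasedHyperbolic : {A : Set} (Vtx : A → Set) (Adj : A → A → Set) (height : A → ℕ) (B : ℕ) → Set
BasedHyperbolic Vtx Adj height B = ∀ {p q r dpq dqr dpr} → Vtx p → Vtx q → Vtx r →
  Dist Adj p q dpq → Dist Adj q r dqr → Dist Adj p r dpr →
  gromov (height p) (height q) dpq ℤ.≤ gromov (height p) (height r) dpr ℤ.+ + B
  ⊎ gromov (height q) (height r) dqr ℤ.≤ gromov (height p) (height r) dpr ℤ.+ + B

based⇒hyperbolic : ∀ {A : Set} {Vtx : A → Set} {Adj : A → A → Set} → (∀ {a b} → Adj a b → Adj b a) →
                   ∀ height B → BasedHyperbolic Vtx Adj height B → Hyperbolic Vtx Adj
based⇒hyperbolic Adj-sym height B based =
  B , λ w x y z vw vx vy vz dxy dxz dyz dwx dwy dwz Dxy Dxz Dyz Dwx Dwy Dwz →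
  four-point-≤ (height w) (height x) (height y) (height z) dwx dwy dwz dxy dxz dyz B (paired-sum-≤
    (Sum.map₂ (subst (ℤ._≤ _) (gromov-comm (height z) (height y) dyz))
      (based vx vz vy Dxz (Dist-sym Adj-sym Dyz) Dxy))
    (Sum.swap (Sum.map₁ (subst (ℤ._≤ _) (gromov-comm (height x) (height w) dwx))
      (based vx vw vy (Dist-sym Adj-sym Dwx) Dwy Dxy)))
    (based vw vx vz Dwx Dxz Dwz)
    (based vw vy vz Dwy Dyz Dwz))

module _ {A : Set} where

  drop-++ : ∀ {n} (w u : List A) → length w ≡ n → drop n (w ++ u) ≡ u
  drop-++ []      u refl = refl
  drop-++ (x ∷ w) u refl = drop-++ w u refl

  take-++ : ∀ {n} (w u : List A) → length w ≡ n → take n (w ++ u) ≡ w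
  take-++ []      u refl = refl
  take-++ (x ∷ w) u refl = cong (x ∷_) (take-++ w u refl)

module _ (𝒱 : VERS) where
  open VERS 𝒱

  module _ {U : Set} {BE : U → U → Fin nC → Set} where

    ExpAdj-sym : ∀ {k p q} → ExpAdj 𝒱 BE k p q → ExpAdj 𝒱 BE k q p
    ExpAdj-sym (c , inj₁ e) = c , inj₂ e
    ExpAdj-sym (c , inj₂ e) = c , inj₁ e

    end-length : ∀ {k} {p q : Word 𝒱 × U} l → length (proj₁ p) ≡ k → length (proj₁ q) ≡ k →
                 length (proj₁ (end 𝒱 p q l)) ≡ suc k
    end-length (ini , x) ∣p∣ _ = cong suc ∣p∣
    end-length (ter , y) _ ∣q∣ = cong suc ∣q∣

    ExpEdge-length : ∀ {k p q c} → ExpEdge 𝒱 BE k p q c → length (proj₁ p) ≡ k × length (proj₁ q) ≡ k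
    ExpEdge-length (base e) = refl , refl
    ExpEdge-length (expd {c = c} e r) with ExpEdge-length e
    ... | ∣p∣ , ∣q∣ = end-length (Rsrc c r) ∣p∣ ∣q∣ , end-length (Rtgt c r) ∣p∣ ∣q∣

    ExpAdj-length : ∀ {k p q} → ExpAdj 𝒱 BE k p q → length (proj₁ p) ≡ k × length (proj₁ q) ≡ k
    ExpAdj-length (c , inj₁ e) = ExpEdge-length e
    ExpAdj-length (c , inj₂ e) = Prod.swap (ExpEdge-length e)

    expansion-respects : {R : U → U → Set} → (∀ {u} → R u u) → (∀ {u v} → R u v → R v u) →
                         (∀ {u v c} → BE u v c → R u v) →
                         ∀ {k p q c} → ExpEdge 𝒱 BE k p q c → R (proj₂ p) (proj₂ q)
    expansion-respects R-refl R-sym BE⇒R (base e) = BE⇒R e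
    expansion-respects R-refl R-sym BE⇒R (expd {c = c} e r)
      with expansion-respects R-refl R-sym BE⇒R e | Rsrc c r | Rtgt c r
    ... | pRq | ini , x | ini , y = R-refl
    ... | pRq | ini , x | ter , y = pRq
    ... | pRq | ter , x | ini , y = R-sym pRq
    ... | pRq | ter , x | ter , y = R-refl

  Compatible : {U : Set} → (U → U → Fin nC → Set) → (U → Fin nV) → Set
  Compatible BE ty = ∀ {u v c} → BE u v c → κ₁ c ≡ ty u × κ₂ c ≡ ty v

  module _ {U : Set} {BE : U → U → Fin nC → Set} {ty : U → Fin nV} where

    typeOf : Word 𝒱 × U → Fin nV
    typeOf (w , u) = typeFrom 𝒱 (ty u) w

    Valid : Word 𝒱 × U → Set
    Valid (w , u) = ValidFrom 𝒱 (ty u) w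

    end-valid : ∀ {p q c} l → Valid p → Valid q → κ₁ c ≡ typeOf p → κ₂ c ≡ typeOf q →
                RVert ι κ₁ κ₂ c l → Valid (end 𝒱 p q l) × typeOf (end 𝒱 p q l) ≡ τ (proj₂ l)
    end-valid (ini , x) vp _ κ₁≡ _ ιx≡ = (vp , trans ιx≡ κ₁≡) , refl
    end-valid (ter , y) _ vq _ κ₂≡ ιy≡ = (vq , trans ιy≡ κ₂≡) , refl

    expansion-compatible : Compatible BE ty → ∀ {k p q c} → ExpEdge 𝒱 BE k p q c →
                           (Valid p × Valid q) × (κ₁ c ≡ typeOf p × κ₂ c ≡ typeOf q)
    expansion-compatible compat (base e) = (tt , tt) , compat e
    expansion-compatible compat (expd {c = c} e r) with expansion-compatible compat e
    ... | (vp , vq) , (κ₁≡ , κ₂≡)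
      with end-valid (Rsrc c r) vp vq κ₁≡ κ₂≡ (proj₁ (Rvert c r))
         | end-valid (Rtgt c r) vp vq κ₁≡ κ₂≡ (proj₂ (Rvert c r))
    ... | vs , ts | vt , tt′ =
      (vs , vt) , (trans (sym (proj₁ (Rcompat c r))) (sym ts) , trans (sym (proj₂ (Rcompat c r))) (sym tt′))

    ExpAdj-vertices : Compatible BE ty → ∀ {k p q} → ExpAdj 𝒱 BE k p q →
                      ExpVertex 𝒱 ty k p × ExpVertex 𝒱 ty k q
    ExpAdj-vertices compat (c , inj₁ e) with ExpEdge-length e | proj₁ (expansion-compatible compat e)
    ... | ∣p∣ , ∣q∣ | vp , vq = (∣p∣ , vp) , (∣q∣ , vq)
    ExpAdj-vertices compat (c , inj₂ e) with ExpEdge-length e | proj₁ (expansion-compatible compat e)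
    ... | ∣q∣ , ∣p∣ | vq , vp = (∣p∣ , vp) , (∣q∣ , vq)

  module _ {U U′ : Set} {BE : U → U → Fin nC → Set} {BE′ : U′ → U′ → Fin nC → Set}
           (f : U → U′) (f-edge : ∀ {u v c} → BE u v c → BE′ (f u) (f v) c) where

    end-map : ∀ (p q : Word 𝒱 × U) l → end 𝒱 (Prod.map₂ f p) (Prod.map₂ f q) l ≡ Prod.map₂ f (end 𝒱 p q l)
    end-map p q (ini , x) = refl
    end-map p q (ter , y) = refl

    expansion-map : ∀ {k p q c} → ExpEdge 𝒱 BE k p q c → ExpEdge 𝒱 BE′ k (Prod.map₂ f p) (Prod.map₂ f q) c
    expansion-map (base e) = base (f-edge e)
    expansion-map (expd {p = p} {q} {c} e r) =
      subst₂ (λ s t → ExpEdge 𝒱 BE′ _ s t _) (end-map p q (Rsrc c r)) (end-map p q (Rtgt c r))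
        (expd (expansion-map e) r)

    ExpAdj-map : ∀ {k p q} → ExpAdj 𝒱 BE k p q → ExpAdj 𝒱 BE′ k (Prod.map₂ f p) (Prod.map₂ f q)
    ExpAdj-map (c , inj₁ e) = c , inj₁ (expansion-map e)
    ExpAdj-map (c , inj₂ e) = c , inj₂ (expansion-map e)

  data SingleEdge (c₀ : Fin nC) : Lbl → Lbl → Fin nC → Set where
    edge : SingleEdge c₀ ini ter c₀

  module _ {U : Set} where

    -- The vertex over the edge p → q corresponding to a vertex of the expansion of a single edge.
    glue : Word 𝒱 × U → Word 𝒱 × U → Word 𝒱 × Lbl → Word 𝒱 × U
    glue (w₁ , u) _ (w , ini) = (w ++ w₁ , u)
    glue _ (w₂ , v) (w , ter) = (w ++ w₂ , v)

    end-glue : ∀ p q i j l → end 𝒱 (glue p q i) (glue p q j) l ≡ glue p q (end 𝒱 i j l)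
    end-glue p q (w , ini) j (ini , x) = refl
    end-glue p q (w , ter) j (ini , x) = refl
    end-glue p q i (w , ini) (ter , y) = refl
    end-glue p q i (w , ter) (ter , y) = refl

  module _ {U : Set} {BE : U → U → Fin nC → Set} where

    -- An edge of the (n + k)-th expansion lies over an edge of the k-th one.
    data Split (n k : ℕ) (p q : Word 𝒱 × U) (c : Fin nC) : Set where
      split : ∀ {p₀ q₀ c₀ i j} → ExpEdge 𝒱 BE k p₀ q₀ c₀ → ExpEdge 𝒱 (SingleEdge c₀) n i j c →
              p ≡ glue p₀ q₀ i → q ≡ glue p₀ q₀ j → Split n k p q c

    expansion-split : ∀ n {k p q c} → ExpEdge 𝒱 BE (n + k) p q c → Split n k p q c
    expansion-split zero    e = split e (base edge) refl refl
    expansion-split (suc n) (expd {c = c} e r) with expansion-split n e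
    ... | split e₀ s refl refl =
      split e₀ (expd s r) (end-glue _ _ _ _ (Rsrc c r)) (end-glue _ _ _ _ (Rtgt c r))

  Horizontal : ℕ → Word 𝒱 → Word 𝒱 → Set
  Horizontal k a b = ExpAdj 𝒱 (Γ₀Edge 𝒱) k (a , tt) (b , tt)

  HWalk : ℕ → Word 𝒱 → Word 𝒱 → ℕ → Set
  HWalk k = Walk (Horizontal k)

  -- In the crossing cases, take n a and take n b locate a and b in the n-th expansion of the edge of Γ_k below.
  data Projection (n k : ℕ) (a b : Word 𝒱) : Set where
    same     : drop n a ≡ drop n b → Projection n k a b
    forward  : ∀ {c₀} → ExpEdge 𝒱 (Γ₀Edge 𝒱) k (drop n a , tt) (drop n b , tt) c₀ →
               ExpAdj 𝒱 (SingleEdge c₀) n (take n a , ini) (take n b , ter) → Projection n k a b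
    backward : ∀ {c₀} → ExpEdge 𝒱 (Γ₀Edge 𝒱) k (drop n b , tt) (drop n a , tt) c₀ →
               ExpAdj 𝒱 (SingleEdge c₀) n (take n a , ter) (take n b , ini) → Projection n k a b

  Projection-sym : ∀ {n k a b} → Projection n k a b → Projection n k b a
  Projection-sym (same eq)      = same (sym eq)
  Projection-sym (forward e s)  = backward e (ExpAdj-sym s)
  Projection-sym (backward e s) = forward e (ExpAdj-sym s)

  ExpEdge-subst : ∀ {U : Set} {BE : U → U → Fin nC → Set} {k c w₁ w₁′ w₂ w₂′} {u v : U} →
                  w₁ ≡ w₁′ → w₂ ≡ w₂′ → ExpEdge 𝒱 BE k (w₁ , u) (w₂ , v) c → ExpEdge 𝒱 BE k (w₁′ , u) (w₂′ , v) c
  ExpEdge-subst refl refl e = e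

  projection-over : ∀ {n k c c₀ u v wa wb} la lb → length wa ≡ n → length wb ≡ n →
                    ExpEdge 𝒱 (Γ₀Edge 𝒱) k (u , tt) (v , tt) c₀ → ExpEdge 𝒱 (SingleEdge c₀) n (wa , la) (wb , lb) c →
                    Projection n k (proj₁ (glue (u , tt) (v , tt) (wa , la))) (proj₁ (glue (u , tt) (v , tt) (wb , lb)))
  projection-over {u = u} {v} {wa} {wb} ini ini ∣wa∣ ∣wb∣ e₀ s = same (trans (drop-++ wa u ∣wa∣) (sym (drop-++ wb u ∣wb∣)))
  projection-over {u = u} {v} {wa} {wb} ter ter ∣wa∣ ∣wb∣ e₀ s = same (trans (drop-++ wa v ∣wa∣) (sym (drop-++ wb v ∣wb∣)))
  projection-over {u = u} {v} {wa} {wb} ini ter ∣wa∣ ∣wb∣ e₀ s =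
    forward (ExpEdge-subst (sym (drop-++ wa u ∣wa∣)) (sym (drop-++ wb v ∣wb∣)) e₀)
            (_ , inj₁ (ExpEdge-subst (sym (take-++ wa u ∣wa∣)) (sym (take-++ wb v ∣wb∣)) s))
  projection-over {u = u} {v} {wa} {wb} ter ini ∣wa∣ ∣wb∣ e₀ s =
    backward (ExpEdge-subst (sym (drop-++ wb u ∣wb∣)) (sym (drop-++ wa v ∣wa∣)) e₀)
             (_ , inj₁ (ExpEdge-subst (sym (take-++ wa v ∣wa∣)) (sym (take-++ wb u ∣wb∣)) s))

  project-edge : ∀ n {k a b c} → ExpEdge 𝒱 (Γ₀Edge 𝒱) (n + k) (a , tt) (b , tt) c → Projection n k a b
  project-edge n e with expansion-split n e
  ... | split {u , _} {v , _} {i = wa , la} {wb , lb} e₀ s refl refl =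
    projection-over la lb (proj₁ (ExpEdge-length s)) (proj₂ (ExpEdge-length s)) e₀ s

  Projection⇒Horizontal : ∀ {n k a b} → Projection n k a b → drop n a ≡ drop n b ⊎ Horizontal k (drop n a) (drop n b)
  Projection⇒Horizontal (same eq)      = inj₁ eq
  Projection⇒Horizontal (forward e _)  = inj₂ (_ , inj₁ e)
  Projection⇒Horizontal (backward e _) = inj₂ (_ , inj₂ e)

  project : ∀ n {k a b} → Horizontal (n + k) a b → Projection n k a b
  project n (c , inj₁ e) = project-edge n e
  project n (c , inj₂ e) = Projection-sym (project-edge n e)

  project-walk : ∀ n {k a b h} → HWalk (n + k) a b h → Σ ℕ λ h′ → h′ ≤ h × HWalk k (drop n a) (drop n b) h′
  project-walk n = contractʷ (drop n) (λ e → Projection⇒Horizontal (project n e))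

  HistAdj-sym : ∀ {a b} → HistAdj 𝒱 a b → HistAdj 𝒱 b a
  HistAdj-sym (inj₁ v)              = inj₂ (inj₁ v)
  HistAdj-sym (inj₂ (inj₁ v))       = inj₁ v
  HistAdj-sym (inj₂ (inj₂ (n , e))) = inj₂ (inj₂ (n , ExpAdj-sym e))

  ascend : ∀ t a → t ≤ length a → InL 𝒱 a → Walk (HistAdj 𝒱) a (drop t a) t
  ascend zero    a       _           _   = here
  ascend (suc t) (x ∷ a) (s≤s t≤∣a∣) vxa = step (inj₂ (inj₁ (x , refl , vxa))) (ascend t a t≤∣a∣ (proj₁ vxa))

  record Arch (a b : Word 𝒱) : Set where
    constructor arch
    field
      climbˡ climbʳ level span : ℕ
      ∣a∣ : length a ≡ climbˡ + level
      ∣b∣ : length b ≡ climbʳ + level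
      horizontal : HWalk level (drop climbˡ a) (drop climbʳ b) span

    cost : ℕ
    cost = climbˡ + climbʳ + span

  open Arch

  Arch-sym : ∀ {a b} → Arch a b → Arch b a
  Arch-sym (arch tˡ tʳ ℓ h ∣a∣ ∣b∣ w) = arch tʳ tˡ ℓ h ∣b∣ ∣a∣ (reverseʷ ExpAdj-sym w)

  cost-sym : ∀ {a b} (r : Arch a b) → cost (Arch-sym r) ≡ cost r
  cost-sym r = cong (_+ span r) (+-comm (climbʳ r) (climbˡ r))

  Arch⇒walk : ∀ {a b} (r : Arch a b) → InL 𝒱 a → InL 𝒱 b → Walk (HistAdj 𝒱) a b (cost r)
  Arch⇒walk {a} {b} (arch tˡ tʳ ℓ h ∣a∣ ∣b∣ w) va vb =
    subst (Walk (HistAdj 𝒱) a b) (+-assoc-comm tˡ h tʳ)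
      (ascend tˡ a (climb≤ ∣a∣) va ++ʷ
        (mapʷ (λ x → x) (λ e → inj₂ (inj₂ (ℓ , e))) w ++ʷ reverseʷ HistAdj-sym (ascend tʳ b (climb≤ ∣b∣) vb)))
    where
    climb≤ : ∀ {t n} → n ≡ t + ℓ → t ≤ n
    climb≤ {t} refl = m≤m+n t ℓ
    +-assoc-comm : ∀ x y z → x + (y + z) ≡ x + z + y
    +-assoc-comm = ℕ-Solver.solve-∀

  Arch-refl : ∀ a → Arch a a
  Arch-refl a = arch 0 0 (length a) 0 refl refl here

  Arch-step : ∀ {a a₁ b} → HistAdj 𝒱 a a₁ → (r : Arch a₁ b) → Σ (Arch a b) λ r′ → cost r′ ≤ suc (cost r)
  Arch-step (inj₁ (x , refl , _)) (arch (suc tˡ) tʳ ℓ h ∣a₁∣ ∣b∣ w) =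
    arch tˡ tʳ ℓ h (suc-injective ∣a₁∣) ∣b∣ w , m≤n⇒m≤1+n (n≤1+n _)
  -- Stepping down into the start of the crossing: project the crossing one level up instead.
  Arch-step {a} {b = b} (inj₁ (x , refl , _)) (arch zero tʳ .(suc (length a)) h refl ∣b∣ w)
    with project-walk 1 w
  ... | h′ , h′≤h , w′ =
    arch 0 (tʳ + 1) (length a) h′ refl (trans ∣b∣ (+-suc-assoc tʳ (length a)))
         (subst (λ y → HWalk (length a) a y h′) (drop-drop tʳ 1 b) w′) ,
    subst (_≤ suc (tʳ + h)) (sym (+-suc-assoc′ tʳ h′)) (s≤s (+-monoʳ-≤ tʳ h′≤h))
    where
    +-suc-assoc : ∀ x y → x + suc y ≡ x + 1 + y
    +-suc-assoc = ℕ-Solver.solve-∀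
    +-suc-assoc′ : ∀ x y → x + 1 + y ≡ suc (x + y)
    +-suc-assoc′ = ℕ-Solver.solve-∀
  Arch-step (inj₂ (inj₁ (x , refl , _))) (arch tˡ tʳ ℓ h ∣a₁∣ ∣b∣ w) =
    arch (suc tˡ) tʳ ℓ h (cong suc ∣a₁∣) ∣b∣ w , ≤-refl
  Arch-step {a} {a₁} {b} (inj₂ (inj₂ (n , e))) (arch tˡ tʳ ℓ h ∣a₁∣ ∣b∣ w) =
    prepend (Projection⇒Horizontal (project tˡ (subst (λ k → Horizontal k a a₁) n≡ e)))
    where
    n≡ : n ≡ tˡ + ℓ
    n≡ = trans (sym (proj₂ (ExpAdj-length e))) ∣a₁∣
    a-height : length a ≡ tˡ + ℓ
    a-height = trans (proj₁ (ExpAdj-length e)) n≡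
    prepend : drop tˡ a ≡ drop tˡ a₁ ⊎ Horizontal ℓ (drop tˡ a) (drop tˡ a₁) →
              Σ (Arch a b) λ r′ → cost r′ ≤ suc (tˡ + tʳ + h)
    prepend (inj₁ eq) = arch tˡ tʳ ℓ h a-height ∣b∣ (subst (λ y → HWalk ℓ y _ h) (sym eq) w) , n≤1+n _
    prepend (inj₂ e′) = arch tˡ tʳ ℓ (suc h) a-height ∣b∣ (step e′ w) , ≤-reflexive (+-suc (tˡ + tʳ) h)

  walk⇒Arch : ∀ {a b L} → Walk (HistAdj 𝒱) a b L → Σ (Arch a b) λ r → cost r ≤ L
  walk⇒Arch {a} here       = Arch-refl a , z≤n
  walk⇒Arch (step e w) with walk⇒Arch w
  ... | r , r≤L with Arch-step e r
  ...   | r′ , r′≤r = r′ , ≤-trans r′≤r (s≤s r≤L)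

  Arch-via-root : ∀ {a b} (r : Arch a b) → level r + level r ≤ span r →
                  Σ (Arch a b) λ r′ → cost r′ ≤ cost r × span r′ ≡ 0
  Arch-via-root {a} {b} (arch tˡ tʳ ℓ h ∣a∣ ∣b∣ w) 2ℓ≤h =
    arch (tˡ + ℓ) (tʳ + ℓ) 0 0 (trans ∣a∣ (sym (+-identityʳ _))) (trans ∣b∣ (sym (+-identityʳ _))) at-root ,
    subst (_≤ tˡ + tʳ + h) (sym (rearrange tˡ tʳ ℓ)) (+-monoʳ-≤ (tˡ + tʳ) 2ℓ≤h) ,
    refl
    where
    at-root : HWalk 0 (drop (tˡ + ℓ) a) (drop (tʳ + ℓ) b) 0
    at-root rewrite drop-all (tˡ + ℓ) a (≤-reflexive ∣a∣) | drop-all (tʳ + ℓ) b (≤-reflexive ∣b∣) = here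
    rearrange : ∀ tˡ tʳ ℓ → tˡ + ℓ + (tʳ + ℓ) + 0 ≡ tˡ + tʳ + (ℓ + ℓ)
    rearrange = ℕ-Solver.solve-∀

  Arch-join : ∀ {a b c} (r₁ : Arch a b) (r₂ : Arch b c) → level r₁ ≤ level r₂ →
              Σ (Arch a c) λ r → cost r + length b ≤ cost r₁ + length c + span r₂
  Arch-join {a} {b} {c} (arch ta tb₁ ℓ₁ h₁ ∣a∣ ∣b∣₁ w₁) (arch tb₂ tc ℓ₂ h₂ ∣b∣₂ ∣c∣ w₂) ℓ₁≤ℓ₂
    with ℓ₂ ∸ ℓ₁ | m∸n+n≡m ℓ₁≤ℓ₂
  ... | t | refl with project-walk t w₂
  ...   | h₂′ , h₂′≤h₂ , w₂′ =
    arch ta (tc + t) ℓ₁ (h₁ + h₂′) ∣a∣ ∣c∣′ (w₁ ++ʷ subst₂ (λ x y → HWalk ℓ₁ x y h₂′) drop-b (drop-drop tc t c) w₂′) ,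
    (begin
      ta + (tc + t) + (h₁ + h₂′) + length b         ≡⟨ cong (λ n → ta + (tc + t) + (h₁ + h₂′) + n) ∣b∣₁ ⟩
      ta + (tc + t) + (h₁ + h₂′) + (tb₁ + ℓ₁)       ≡⟨ rearrange ta tb₁ h₁ tc t ℓ₁ h₂′ ⟩
      ta + tb₁ + h₁ + (tc + t + ℓ₁) + h₂′           ≤⟨ +-monoʳ-≤ (ta + tb₁ + h₁ + (tc + t + ℓ₁)) h₂′≤h₂ ⟩
      ta + tb₁ + h₁ + (tc + t + ℓ₁) + h₂            ≡⟨ cong (λ n → ta + tb₁ + h₁ + n + h₂) (sym ∣c∣′) ⟩
      ta + tb₁ + h₁ + length c + h₂                 ∎)
    where
    open ≤-Reasoning
    ∣c∣′ : length c ≡ tc + t + ℓ₁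
    ∣c∣′ = trans ∣c∣ (sym (+-assoc tc t ℓ₁))
    climbs : tb₂ + t ≡ tb₁
    climbs = +-cancelʳ-≡ ℓ₁ (tb₂ + t) tb₁ (trans (+-assoc tb₂ t ℓ₁) (trans (sym ∣b∣₂) ∣b∣₁))
    drop-b : drop t (drop tb₂ b) ≡ drop tb₁ b
    drop-b = trans (drop-drop tb₂ t b) (cong (λ n → drop n b) climbs)
    rearrange : ∀ ta tb h₁ tc t ℓ h₂ → ta + (tc + t) + (h₁ + h₂) + (tb + ℓ) ≡ ta + tb + h₁ + (tc + t + ℓ) + h₂
    rearrange = ℕ-Solver.solve-∀

  open PathGraph using (ty; Edge)

  PathGraph-compatible : ∀ {n} (P : PathGraph 𝒱 n) → Compatible (Edge P) (ty P)
  PathGraph-compatible P (j , refl , inj₁ (fwd≡ , refl , refl)) with PathGraph.compat P j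
  ... | inj₁ (_ , κ₁≡ , κ₂≡) = κ₁≡ , κ₂≡
  ... | inj₂ (fwd≡′ , _ , _) with trans (sym fwd≡) fwd≡′
  ...   | ()
  PathGraph-compatible P (j , refl , inj₂ (fwd≡ , refl , refl)) with PathGraph.compat P j
  ... | inj₂ (_ , κ₁≡ , κ₂≡) = κ₁≡ , κ₂≡
  ... | inj₁ (fwd≡′ , _ , _) with trans (sym fwd≡′) fwd≡
  ...   | ()

  -- f₀ says whether the new edge points away from the new vertex 0.
  extend-path : ∀ {n} (t₀ : Fin nV) (c₀ : Fin nC) (f₀ : Bool) (P : PathGraph 𝒱 n) →
                (f₀ ≡ true × κ₁ c₀ ≡ t₀ × κ₂ c₀ ≡ ty P zero) ⊎ (f₀ ≡ false × κ₁ c₀ ≡ ty P zero × κ₂ c₀ ≡ t₀) →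
                PathGraph 𝒱 (suc n)
  extend-path {n} t₀ c₀ f₀ P compat₀ = record { ty = ty′ ; col = col′ ; fwd = fwd′ ; compat = compat′ }
    where
    ty′ : Fin (suc (suc n)) → Fin nV
    ty′ zero    = t₀
    ty′ (suc i) = ty P i
    col′ : Fin (suc n) → Fin nC
    col′ zero    = c₀
    col′ (suc j) = PathGraph.col P j
    fwd′ : Fin (suc n) → Bool
    fwd′ zero    = f₀
    fwd′ (suc j) = PathGraph.fwd P j
    compat′ : ∀ j → (fwd′ j ≡ true  × κ₁ (col′ j) ≡ ty′ (inject₁ j) × κ₂ (col′ j) ≡ ty′ (suc j))
                  ⊎ (fwd′ j ≡ false × κ₁ (col′ j) ≡ ty′ (suc j) × κ₂ (col′ j) ≡ ty′ (inject₁ j))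
    compat′ zero    = compat₀
    compat′ (suc j) = PathGraph.compat P j

  extend-path-shift : ∀ {n t₀ c₀ f₀} {P : PathGraph 𝒱 n} {compat₀} {u v c} →
                      Edge P u v c → Edge (extend-path t₀ c₀ f₀ P compat₀) (suc u) (suc v) c
  extend-path-shift (j , col≡ , inj₁ (fwd≡ , refl , refl)) = suc j , col≡ , inj₁ (fwd≡ , refl , refl)
  extend-path-shift (j , col≡ , inj₂ (fwd≡ , refl , refl)) = suc j , col≡ , inj₂ (fwd≡ , refl , refl)

  -- SingleEdge runs ini → ter, while the new edge of the extended path runs 0 → 1 if f₀ and 1 → 0 otherwise.
  new-edge-vertex : ∀ {n} → Bool → Lbl → Fin (suc (suc n))
  new-edge-vertex true  ini = zero
  new-edge-vertex true  ter = suc zero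
  new-edge-vertex false ini = suc zero
  new-edge-vertex false ter = zero

  extend-path-head : ∀ {n t₀ c₀} f₀ {P : PathGraph 𝒱 n} {compat₀} {u v c} →
                     SingleEdge c₀ u v c → Edge (extend-path t₀ c₀ f₀ P compat₀) (new-edge-vertex f₀ u) (new-edge-vertex f₀ v) c
  extend-path-head true  edge = zero , refl , inj₁ (refl , refl , refl)
  extend-path-head false edge = zero , refl , inj₂ (refl , refl , refl)

  Close : ∀ {m} → Fin m → Fin m → Set
  Close i j = toℕ j ≤ suc (toℕ i) × toℕ i ≤ suc (toℕ j)

  inject₁-close-suc : ∀ {n} (j : Fin n) → Close (inject₁ j) (suc j)
  inject₁-close-suc j =
    s≤s (≤-reflexive (sym (toℕ-inject₁ j))) , ≤-trans (≤-reflexive (toℕ-inject₁ j)) (m≤n+m _ 2)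

  path-edge-close : ∀ {n} (P : PathGraph 𝒱 n) {u v c} → Edge P u v c → Close u v
  path-edge-close P (j , _ , inj₁ (_ , refl , refl)) = inject₁-close-suc j
  path-edge-close P (j , _ , inj₂ (_ , refl , refl)) = Prod.swap (inject₁-close-suc j)

  path-expansion-close : ∀ {n} (P : PathGraph 𝒱 n) {k p q c} → ExpEdge 𝒱 (Edge P) k p q c → Close (proj₂ p) (proj₂ q)
  path-expansion-close P = expansion-respects (n≤1+n _ , n≤1+n _) Prod.swap (path-edge-close P)

  path-adj-index : ∀ {n} (P : PathGraph 𝒱 n) {k p q} → ExpAdj 𝒱 (Edge P) k p q → toℕ (proj₂ q) ≤ suc (toℕ (proj₂ p))
  path-adj-index P (c , inj₁ e) = proj₁ (path-expansion-close P e)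
  path-adj-index P (c , inj₂ e) = proj₂ (path-expansion-close P e)

  path-walk-index : ∀ {n} (P : PathGraph 𝒱 n) {k p q m} → Walk (ExpAdj 𝒱 (Edge P) k) p q m →
                    toℕ (proj₂ q) ≤ toℕ (proj₂ p) + m
  path-walk-index P {p = p} here = ≤-reflexive (sym (+-identityʳ (toℕ (proj₂ p))))
  path-walk-index P {p = p} {q} {suc m} (step {b = p₁} e w) = begin
    toℕ (proj₂ q)              ≤⟨ path-walk-index P w ⟩
    toℕ (proj₂ p₁) + m         ≤⟨ +-monoˡ-≤ m (path-adj-index P e) ⟩
    suc (toℕ (proj₂ p)) + m    ≡⟨ sym (+-suc (toℕ (proj₂ p)) m) ⟩
    toℕ (proj₂ p) + suc m      ∎
    where open ≤-Reasoning

  path-expansion-geodesic : ∀ {n} (P : PathGraph 𝒱 n) {w w′} →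
                            Walk (ExpAdj 𝒱 (Edge P) n) (w , zero) (w′ , fromℕ n) n →
                            Dist (ExpAdj 𝒱 (Edge P) n) (w , zero) (w′ , fromℕ n) n
  path-expansion-geodesic {n} P W =
    W , λ m m<n W′ → <⇒≱ m<n (subst (_≤ m) (toℕ-fromℕ n) (path-walk-index P W′))

  Γ₀-compatible : Compatible (Γ₀Edge 𝒱) (λ _ → s)
  Γ₀-compatible (b , refl) = Bcompat b

  point : Fin nV → PathGraph 𝒱 0
  point t = record { ty = λ _ → t ; col = λ () ; fwd = λ () ; compat = λ () }

  -- A horizontal walk of length n in Γ_{N+k} read off as a walk in the N-th expansion of a path of length n.
  record Lift (N n : ℕ) (a b : Word 𝒱) : Set where
    constructor lift
    field
      path       : PathGraph 𝒱 n
      path-start : ty path zero ≡ typeFrom 𝒱 s (drop N a)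
      lifted     : Walk (ExpAdj 𝒱 (Edge path) N) (take N a , zero) (take N b , fromℕ n) n

  Lift-refl : ∀ {N} a → Lift N 0 a a
  Lift-refl {N} a = lift (point (typeFrom 𝒱 s (drop N a))) refl here

  Lift-forward : ∀ {N n k a a₁ b c₀} → ExpEdge 𝒱 (Γ₀Edge 𝒱) k (drop N a , tt) (drop N a₁ , tt) c₀ →
                 ExpAdj 𝒱 (SingleEdge c₀) N (take N a , ini) (take N a₁ , ter) → Lift N n a₁ b → Lift N (suc n) a b
  Lift-forward e₀ s (lift P start W) =
    lift (extend-path _ _ true P compat₀) refl (step (ExpAdj-map (new-edge-vertex true) (extend-path-head true {P = P} {compat₀}) s)
                      (mapʷ (Prod.map₂ suc) (ExpAdj-map suc (extend-path-shift {P = P} {compat₀})) W))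
    where
    κ≡ = proj₂ (expansion-compatible Γ₀-compatible e₀)
    compat₀ = inj₁ (refl , proj₁ κ≡ , trans (proj₂ κ≡) (sym start))

  Lift-backward : ∀ {N n k a a₁ b c₀} → ExpEdge 𝒱 (Γ₀Edge 𝒱) k (drop N a₁ , tt) (drop N a , tt) c₀ →
                  ExpAdj 𝒱 (SingleEdge c₀) N (take N a , ter) (take N a₁ , ini) → Lift N n a₁ b → Lift N (suc n) a b
  Lift-backward e₀ s (lift P start W) =
    lift (extend-path _ _ false P compat₀) refl (step (ExpAdj-map (new-edge-vertex false) (extend-path-head false {P = P} {compat₀}) s)
                      (mapʷ (Prod.map₂ suc) (ExpAdj-map suc (extend-path-shift {P = P} {compat₀})) W))
    where
    κ≡ = proj₂ (expansion-compatible Γ₀-compatible e₀)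
    compat₀ = inj₂ (refl , trans (proj₁ κ≡) (sym start) , proj₂ κ≡)

  shorten-or-lift : ∀ N {k a b n} → HWalk (N + k) a b n →
                    (Σ ℕ λ m → m < n × HWalk k (drop N a) (drop N b) m) ⊎ Lift N n a b
  shorten-or-lift N {a = a} here = inj₂ (Lift-refl a)
  shorten-or-lift N (step e w) with shorten-or-lift N w | project N e
  ... | inj₁ (m , m<n , w′) | π with step-or-stay (Projection⇒Horizontal π) w′
  ...   | m′ , m′≤ , w″ = inj₁ (m′ , s≤s (≤-trans m′≤ m<n) , w″)
  shorten-or-lift N (step e w) | inj₂ L | same eq with project-walk N w
  ... | m , m≤n , w′ = inj₁ (m , s≤s m≤n , subst (λ x → HWalk _ x _ m) (sym eq) w′)
  shorten-or-lift N (step e w) | inj₂ L | forward e₀ s  = inj₂ (Lift-forward e₀ s L)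
  shorten-or-lift N (step e w) | inj₂ L | backward e₀ s = inj₂ (Lift-backward e₀ s L)

  module Expanding (N′ : ℕ) (expanding : NExpanding 𝒱 (suc N′)) where

    N : ℕ
    N = suc N′

    no-lift : ∀ {a b} → ¬ Lift N N a b
    no-lift {a} {b} (lift P _ W) with W | reverseʷ ExpAdj-sym W
    ... | step e _ | step e′ _ =
      expanding P (take N a , take N b , proj₁ (ExpAdj-vertices (PathGraph-compatible P) e) ,
                   proj₁ (ExpAdj-vertices (PathGraph-compatible P) e′) , path-expansion-geodesic P W)

    shrink : ∀ {k a b} → HWalk (N + k) a b N → Σ ℕ λ m → m < N × HWalk k (drop N a) (drop N b) m
    shrink w with shorten-or-lift N w
    ... | inj₁ shorter = shorter
    ... | inj₂ L       = ⊥-elim (no-lift L)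

    contract : ∀ q {k a b D} → q * N ≤ D → HWalk (N + k) a b D →
               Σ ℕ λ D′ → D′ + q ≤ D × HWalk k (drop N a) (drop N b) D′
    contract zero _ w with project-walk N w
    ... | D′ , D′≤D , w′ = D′ , subst (_≤ _) (sym (+-identityʳ D′)) D′≤D , w′
    contract (suc q) {k} qN≤D w with m≤n⇒∃[o]m+o≡n (≤-trans (m≤m+n N (q * N)) qN≤D)
    ... | D₀ , refl with splitʷ N w
    ...   | _ , w₁ , w₂ with shrink w₁ | contract q {k} (+-cancelˡ-≤ N _ _ qN≤D) w₂
    ...     | m , m<N , w₁′ | D₂ , D₂+q≤D₀ , w₂′ =
      m + D₂ , subst (_≤ N + D₀) (sym (rearrange m D₂ q)) (+-mono-≤ m<N D₂+q≤D₀) , w₁′ ++ʷ w₂′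
      where
      rearrange : ∀ m D q → m + D + suc q ≡ suc m + (D + q)
      rearrange = ℕ-Solver.solve-∀

    Arch-lower : ∀ {a b} (r : Arch a b) → N ≤ level r → (N + N) * N ≤ span r →
                 Σ (Arch a b) λ r′ → cost r′ ≤ cost r × level r′ < level r
    Arch-lower {a} {b} (arch tˡ tʳ ℓ h ∣a∣ ∣b∣ w) N≤ℓ bound with m≤n⇒∃[o]m+o≡n N≤ℓ
    ... | ℓ′ , refl with contract (N + N) bound w
    ...   | D′ , D′+2N≤h , w′ =
      arch (tˡ + N) (tʳ + N) ℓ′ D′ (trans ∣a∣ (sym (+-assoc tˡ N ℓ′))) (trans ∣b∣ (sym (+-assoc tʳ N ℓ′)))
           (subst₂ (λ x y → HWalk ℓ′ x y D′) (drop-drop tˡ N a) (drop-drop tʳ N b) w′) ,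
      subst (_≤ tˡ + tʳ + h) (sym (rearrange tˡ tʳ N D′)) (+-monoʳ-≤ (tˡ + tʳ) D′+2N≤h) ,
      m<n+m ℓ′ (s≤s z≤n)
      where
      rearrange : ∀ tˡ tʳ N D → tˡ + N + (tʳ + N) + D ≡ tˡ + tʳ + (D + (N + N))
      rearrange = ℕ-Solver.solve-∀

    B : ℕ
    B = (N + N) * N + (N + N)

    shorten : ∀ fuel {a b} (r : Arch a b) → level r ≤ fuel → Σ (Arch a b) λ r′ → cost r′ ≤ cost r × span r′ ≤ B
    shorten fuel r ℓ≤fuel with span r ≤? B | level r <? N
    ... | yes h≤B | _ = r , ≤-refl , h≤B
    ... | no h≰B | yes ℓ<N with Arch-via-root r 2ℓ≤h
      where
      2ℓ≤h = ≤-trans (+-mono-≤ (<⇒≤ ℓ<N) (<⇒≤ ℓ<N)) (≤-trans (m≤n+m (N + N) ((N + N) * N)) (<⇒≤ (≰⇒> h≰B)))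
    ...   | r′ , r′≤r , h′≡0 = r′ , r′≤r , subst (_≤ B) (sym h′≡0) z≤n
    shorten zero       r ℓ≤0     | no _   | no ℓ≮N = ⊥-elim (ℓ≮N (≤-trans (s≤s ℓ≤0) (s≤s z≤n)))
    shorten (suc fuel) r ℓ≤fuel | no h≰B | no ℓ≮N
      with Arch-lower r (≮⇒≥ ℓ≮N) (≤-trans (m≤m+n _ _) (<⇒≤ (≰⇒> h≰B)))
    ... | r′ , r′≤r , ℓ′<ℓ with shorten fuel r′ (≤-pred (≤-trans ℓ′<ℓ ℓ≤fuel))
    ...   | r″ , r″≤r′ , h″≤B = r″ , ≤-trans r″≤r′ r′≤r , h″≤B

    geodesic⇒Arch : ∀ {a b d} → Dist (HistAdj 𝒱) a b d → InL 𝒱 a → InL 𝒱 b →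
                    Σ (Arch a b) λ r → cost r ≡ d × span r ≤ B
    geodesic⇒Arch D va vb with walk⇒Arch (proj₁ D)
    ... | r₀ , r₀≤d with shorten (level r₀) r₀ ≤-refl
    ...   | r , r≤r₀ , h≤B = r , ≤-antisym (≤-trans r≤r₀ r₀≤d) (Dist⇒≤ D (Arch⇒walk r va vb)) , h≤B

    join-≤ : ∀ {a b c d} (r₁ : Arch a b) (r₂ : Arch b c) → level r₁ ≤ level r₂ → span r₂ ≤ B →
             Dist (HistAdj 𝒱) a c d → InL 𝒱 a → InL 𝒱 c → d + length b ≤ cost r₁ + length c + B
    join-≤ {b = b} {c} r₁ r₂ ℓ₁≤ℓ₂ h₂≤B D va vc with Arch-join r₁ r₂ ℓ₁≤ℓ₂
    ... | r , bound =
      ≤-trans (+-monoˡ-≤ (length b) (Dist⇒≤ D (Arch⇒walk r va vc))) (≤-trans bound (+-monoʳ-≤ (cost r₁ + length c) h₂≤B))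

    history-based-hyperbolic : BasedHyperbolic (InL 𝒱) (HistAdj 𝒱) length B
    history-based-hyperbolic {p} {q} {r} {dpq} {dqr} {dpr} vp vq vr Dpq Dqr Dpr
      with geodesic⇒Arch Dpq vp vq | geodesic⇒Arch Dqr vq vr
    ... | r₁ , refl , h₁≤B | r₂ , refl , h₂≤B with ≤-total (level r₁) (level r₂)
    ...   | inj₁ ℓ₁≤ℓ₂ = inj₁ (gromov-≤ (length p) (length q) (length r) dpq dpr B (join-≤ r₁ r₂ ℓ₁≤ℓ₂ h₂≤B Dpr vp vr))
    ...   | inj₂ ℓ₂≤ℓ₁ =
      inj₂ (subst₂ ℤ._≤_ (gromov-comm (length r) (length q) dqr) (cong (ℤ._+ + B) (gromov-comm (length r) (length p) dpr))
             (gromov-≤ (length r) (length q) (length p) dqr dpr B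
               (subst (λ n → dpr + length q ≤ n + length p + B) (cost-sym r₂)
                 (join-≤ (Arch-sym r₂) (Arch-sym r₁) ℓ₂≤ℓ₁ h₁≤B (Dist-sym HistAdj-sym Dpr) vr vp))))

¬NExpanding-zero : (𝒱 : VERS) → ¬ NExpanding 𝒱 0
¬NExpanding-zero 𝒱 expanding =
  expanding (point 𝒱 (VERS.s 𝒱)) ([] , [] , (refl , tt) , (refl , tt) , here , λ _ ())

theorem3p12 : (𝒱 : VERS) → Expanding 𝒱 → HistoryHyperbolic 𝒱
theorem3p12 𝒱 (zero , expanding)     = ⊥-elim (¬NExpanding-zero 𝒱 expanding)
theorem3p12 𝒱 (suc N′ , expanding) =
  based⇒hyperbolic (HistAdj-sym 𝒱) length B history-based-hyperbolic
  where open Expanding 𝒱 N′ expanding
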